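{- Let $k$ be a positive integer. For integers $q\ge 2$ define \[ F_k(q) = \min \{ |kA| : A\subset \mathbb{Z}_q,\ A-A = \mathbb{Z}_q \}, \] \[ G_k(q) = \min \{ |kA| : A\subset \mathbb{Z} \text{ finite},\ A-A \supset \{a+1, \ldots, a+q \} \text{ for some integer } a \}, \] \[ H_k(q) = \min \{ |kA| : A\subset \mathbb{Z} \text{ finite},\ |A-A| \geq q \}. \] Then for all $q\ge 2$: \[ F_k(q) \leq G_k(q), \qquad H_k(q) \leq G_k(q), \qquad G_k(q) \leq G_k(2q+1) \leq 2k F_k(q). \]
   Context: $\mathbb{Z}_q$ denotes the group of residues modulo $q$. For a set $A$ in an abelian group, $kA = A+\cdots+A$ ($k$ times) is the set of all sums of $k$ elements of $A$, and $A-A=\{a-b: a,b\in A\}$. -}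

module Defs where

open import Data.Nat as ℕ using (ℕ; zero; suc; NonZero; _≤_; _<_)
open import Data.Nat.DivMod using (_mod_)
open import Data.Fin as Fin using (Fin; toℕ)
import Data.Fin.Properties as FinP
open import Data.Integer as ℤ using (ℤ; +_)
import Data.Integer.Properties as ℤP
open import Data.List using (List; []; _∷_; [_]; length; deduplicate; concatMap; map)
open import Data.List.Membership.Propositional using (_∈_)
open import Data.Product using (Σ; ∃; _×_; _,_)
open import Relation.Binary.PropositionalEquality using (_≡_)

IsMinimum : (ℕ → Set) → ℕ → Set
IsMinimum P m = P m × (∀ n → P n → m ≤ n)

-- Finite sets are represented by lists (duplicates allowed);
-- the cardinality of the set is the number of distinct entries.

module _ {q : ℕ} {{_ : NonZero q}} where

  _⊕_ : Fin q → Fin q → Fin q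
  a ⊕ b = (toℕ a ℕ.+ toℕ b) mod q

  _⊖_ : Fin q → Fin q → Fin q
  a ⊖ b = (toℕ a ℕ.+ (q ℕ.∸ toℕ b)) mod q

  zeroQ : Fin q
  zeroQ = 0 mod q

sumsetQ : (q : ℕ) {{_ : NonZero q}} → ℕ → List (Fin q) → List (Fin q)
sumsetQ q zero    A = [ zeroQ ]
sumsetQ q (suc k) A = concatMap (λ a → map (λ s → a ⊕ s) (sumsetQ q k A)) A

cardQ : {q : ℕ} → List (Fin q) → ℕ
cardQ xs = length (deduplicate FinP._≟_ xs)

DiffCoverQ : (q : ℕ) {{_ : NonZero q}} → List (Fin q) → Set
DiffCoverQ q A = ∀ (x : Fin q) → ∃ λ a → ∃ λ b → a ∈ A × b ∈ A × (a ⊖ b) ≡ x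

FSet : (k q : ℕ) {{_ : NonZero q}} → ℕ → Set
FSet k q m = Σ (List (Fin q)) λ A → DiffCoverQ q A × cardQ (sumsetQ q k A) ≡ m

sumsetZ : ℕ → List ℤ → List ℤ
sumsetZ zero    A = [ + 0 ]
sumsetZ (suc k) A = concatMap (λ a → map (λ s → a ℤ.+ s) (sumsetZ k A)) A

diffZ : List ℤ → List ℤ
diffZ A = concatMap (λ a → map (λ b → a ℤ.- b) A) A

cardZ : List ℤ → ℕ
cardZ xs = length (deduplicate ℤP._≟_ xs)

ContainsIntervalDiff : ℕ → List ℤ → Set
ContainsIntervalDiff q A =
  ∃ λ (c : ℤ) → ∀ (i : ℕ) → 1 ≤ i → i ≤ q →
    ∃ λ a → ∃ λ b → a ∈ A × b ∈ A × (a ℤ.- b) ≡ c ℤ.+ + i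

GSet : (k q : ℕ) → ℕ → Set
GSet k q m = Σ (List ℤ) λ A → ContainsIntervalDiff q A × cardZ (sumsetZ k A) ≡ m

HSet : (k q : ℕ) → ℕ → Set
HSet k q m = Σ (List ℤ) λ A → q ≤ cardZ (diffZ A) × cardZ (sumsetZ k A) ≡ m

module Submission where

-- Each inequality compares two minima by transporting an optimal set of one
-- problem into an admissible set of the other without enlarging |kA|:
--  * F ≤ G: reduce A ⊆ ℤ modulo q.  Reduction π : ℤ → ℤ_q is a homomorphism
--    that is onto on every block of q consecutive integers, so it turns
--    A − A ⊇ {c+1,…,c+q} into π(A) − π(A) = ℤ_q, and maps kA onto k·π(A).
--  * H ≤ G: q consecutive differences are q distinct elements of A − A.
--  * G ≤ G': a run of 2q+1 consecutive differences contains a run of q.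
--  * G' ≤ 2kF: lift A ⊆ ℤ_q to A' = A ∪ (A + q) ⊆ [0, 2q).  Then A' − A'
--    contains −q,…,q, and kA' ⊆ [0, 2kq) is determined by residues in kA
--    together with quotients in [0, 2k), so |kA'| ≤ 2k·|kA|.
-- The file first proves a counting principle for lists (sizes are counted
-- after deduplication), then congruence modulo q on ℤ, the reduction map and
-- its sumset properties, the doubling construction, and finally the theorem.

open import Defs
open import Data.Nat as ℕ using (ℕ; zero; suc; NonZero; _≤_; _<_; _+_; _*_; _∸_; z≤n; s≤s)
import Data.Nat.Properties as ℕP
open import Data.Nat.DivMod using (_%_; _/_; _mod_; m%n<n; m≡m%n+[m/n]*n; m<n*o⇒m/o<n)
import Data.Nat.Divisibility as ℕDiv
open import Data.Fin as Fin using (Fin; toℕ; fromℕ<)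
import Data.Fin.Properties as FinP
open import Data.Integer as ℤ using (ℤ; +_; -[1+_])
import Data.Integer.Properties as ℤP
open import Data.Integer.DivMod using (_%ℕ_; n%ℕd<d; a≡a%ℕn+[a/ℕn]*n)
open import Data.Integer.Divisibility.Signed using (_∣_; divides; ∣m∣n⇒∣m+n; ∣m∣n⇒∣m-n; ∣m⇒∣-m; ∣⇒∣ᵤ)
open import Data.Integer.Tactic.RingSolver using (solve-∀)
open import Data.Nat.Tactic.RingSolver using () renaming (solve-∀ to ℕ-solve-∀)
open import Data.List using (List; []; _∷_; _++_; length; lookup; deduplicate; concatMap; map; upTo; cartesianProduct)
open import Data.List.Properties using (length-map; length-upTo; length-++)
open import Data.List.Membership.Propositional using (_∈_; find; lose)
open import Data.List.Membership.Propositional.Properties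
  using (∈-map⁺; ∈-map⁻; ∈-concatMap⁺; ∈-concatMap⁻; ∈-lookup; ∈-deduplicate⁺; ∈-deduplicate⁻;
         ∈-upTo⁺; ∈-upTo⁻; ∈-cartesianProduct⁺; ∈-++⁺ˡ; ∈-++⁺ʳ; ∈-++⁻)
open import Data.List.Relation.Unary.Any using (here; index)
open import Data.List.Relation.Unary.Any.Properties using (lookup-index)
import Data.List.Relation.Unary.All as All
open import Data.List.Relation.Unary.AllPairs using (_∷_)
open import Data.List.Relation.Unary.Unique.Propositional using (Unique)
open import Data.List.Relation.Unary.Unique.Propositional.Properties using (map⁺; upTo⁺)
open import Data.List.Relation.Unary.Unique.DecPropositional.Properties using (deduplicate-!)
open import Data.Product using (∃; ∃₂; _×_; _,_; proj₁; proj₂)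
open import Data.Sum using (_⊎_; inj₁; inj₂)
open import Data.Empty using (⊥-elim)
open import Function.Base using (id)
open import Function.Definitions using (Injective)
open import Algebra.Properties.AbelianGroup ℤP.+-0-abelianGroup using (∙-cancelˡ)
open import Relation.Binary.Bundles using (Setoid)
open import Relation.Binary.Definitions using (DecidableEquality)
open import Relation.Binary.PropositionalEquality
  using (_≡_; refl; sym; trans; cong; cong₂; subst; module ≡-Reasoning)
open import Relation.Nullary using (yes; no)

private variable A B C : Set

unique-lookup-injective : {xs : List A} → Unique xs →
  ∀ {i j} → lookup xs i ≡ lookup xs j → i ≡ j
unique-lookup-injective (_ ∷ _)  {Fin.zero}  {Fin.zero}  _ = refl
unique-lookup-injective (x∉ ∷ _) {Fin.zero}  {Fin.suc j} e = ⊥-elim (All.lookup x∉ (∈-lookup j) e)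
unique-lookup-injective (x∉ ∷ _) {Fin.suc i} {Fin.zero}  e = ⊥-elim (All.lookup x∉ (∈-lookup i) (sym e))
unique-lookup-injective (_ ∷ u)  {Fin.suc i} {Fin.suc j} e = cong Fin.suc (unique-lookup-injective u e)

-- Pigeonhole for lists: if every entry of a duplicate-free list us is the image
-- under f of some entry of vs, then us is no longer than vs.  Each position of
-- us is sent to the position of a chosen preimage; this map is injective.
length-≤-image : (f : A → B) {us : List B} {vs : List A} → Unique us →
  (∀ {u} → u ∈ us → ∃ λ v → v ∈ vs × f v ≡ u) → length us ≤ length vs
length-≤-image f {us} {vs} us-unique cover = FinP.injective⇒≤ slot-injective
  where
  slot : Fin (length us) → Fin (length vs)
  slot i = index (proj₁ (proj₂ (cover (∈-lookup i))))

  preimage-at-slot : ∀ i → f (lookup vs (slot i)) ≡ lookup us i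
  preimage-at-slot i with cover (∈-lookup i)
  ... | v , v∈vs , fv≡u = trans (cong f (sym (lookup-index v∈vs))) fv≡u

  slot-injective : Injective _≡_ _≡_ slot
  slot-injective {i} {j} slot-i≡slot-j = unique-lookup-injective us-unique (begin
    lookup us i                ≡⟨ sym (preimage-at-slot i) ⟩
    f (lookup vs (slot i))     ≡⟨ cong (λ s → f (lookup vs s)) slot-i≡slot-j ⟩
    f (lookup vs (slot j))     ≡⟨ preimage-at-slot j ⟩
    lookup us j                ∎)
    where open ≡-Reasoning

distinct-≤-length : (_≟_ : DecidableEquality B) (f : A → B) {ys : List B} {xs : List A} →
  (∀ {y} → y ∈ ys → ∃ λ x → x ∈ xs × f x ≡ y) → length (deduplicate _≟_ ys) ≤ length xs
distinct-≤-length _≟_ f {ys} cover =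
  length-≤-image f (deduplicate-! _≟_ ys) (λ y∈ → cover (∈-deduplicate⁻ _≟_ ys y∈))

distinct-image : (_≟A_ : DecidableEquality A) (_≟B_ : DecidableEquality B) (f : A → B)
  {ys : List B} {xs : List A} → (∀ {y} → y ∈ ys → ∃ λ x → x ∈ xs × f x ≡ y) →
  length (deduplicate _≟B_ ys) ≤ length (deduplicate _≟A_ xs)
distinct-image _≟A_ _≟B_ f {ys} {xs} cover = distinct-≤-length _≟B_ f lift-cover
  where
  lift-cover : ∀ {y} → y ∈ ys → ∃ λ x → x ∈ deduplicate _≟A_ xs × f x ≡ y
  lift-cover y∈ with cover y∈
  ... | x , x∈ , fx≡y = x , ∈-deduplicate⁺ _≟A_ x∈ , fx≡y

-- Membership in the list of all sums  a ∙ b  (a from xs, b from ys), the shape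
-- shared by sumsetZ, sumsetQ and diffZ.
module _ (_∙_ : A → B → C) where

  ∈-sums⁺ : ∀ {xs ys a b} → a ∈ xs → b ∈ ys → a ∙ b ∈ concatMap (λ x → map (λ y → x ∙ y) ys) xs
  ∈-sums⁺ {ys = ys} {a = a} a∈ b∈ =
    ∈-concatMap⁺ (λ x → map (λ y → x ∙ y) ys) (lose a∈ (∈-map⁺ (a ∙_) b∈))

  ∈-sums⁻ : ∀ xs ys {c} → c ∈ concatMap (λ x → map (λ y → x ∙ y) ys) xs →
    ∃₂ λ a b → a ∈ xs × b ∈ ys × c ≡ a ∙ b
  ∈-sums⁻ xs ys c∈ with find (∈-concatMap⁻ (λ x → map (λ y → x ∙ y) ys) {xs = xs} c∈)
  ... | a , a∈ , c∈a+ys with ∈-map⁻ (a ∙_) c∈a+ys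
  ...   | b , b∈ , c≡a∙b = a , b , a∈ , b∈ , c≡a∙b

module Congruence (q : ℕ) where

  infix 4 _≈_
  record _≈_ (x y : ℤ) : Set where
    constructor congruent
    field difference-divisible : + q ∣ x ℤ.- y

  ≈-reflexive : ∀ {x y} → x ≡ y → x ≈ y
  ≈-reflexive {x} refl = congruent (divides (+ 0) (trans (ℤP.+-inverseʳ x) (sym (ℤP.*-zeroˡ (+ q)))))

  ≈-sym : ∀ {x y} → x ≈ y → y ≈ x
  ≈-sym {x} {y} (congruent q∣x-y) = congruent (subst (+ q ∣_) (swap x y) (∣m⇒∣-m q∣x-y))
    where
    swap : ∀ x y → ℤ.- (x ℤ.- y) ≡ y ℤ.- x
    swap = solve-∀

  ≈-trans : ∀ {x y z} → x ≈ y → y ≈ z → x ≈ z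
  ≈-trans {x} {y} {z} (congruent q∣x-y) (congruent q∣y-z) =
    congruent (subst (+ q ∣_) (telescope x y z) (∣m∣n⇒∣m+n q∣x-y q∣y-z))
    where
    telescope : ∀ x y z → (x ℤ.- y) ℤ.+ (y ℤ.- z) ≡ x ℤ.- z
    telescope = solve-∀

  ≈-setoid : Setoid _ _
  ≈-setoid = record
    { _≈_ = _≈_
    ; isEquivalence = record { refl = ≈-reflexive refl ; sym = ≈-sym ; trans = ≈-trans } }

  +-cong : ∀ {x y u v} → x ≈ y → u ≈ v → x ℤ.+ u ≈ y ℤ.+ v
  +-cong {x} {y} {u} {v} (congruent q∣x-y) (congruent q∣u-v) =
    congruent (subst (+ q ∣_) (regroup x y u v) (∣m∣n⇒∣m+n q∣x-y q∣u-v))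
    where
    regroup : ∀ x y u v → (x ℤ.- y) ℤ.+ (u ℤ.- v) ≡ (x ℤ.+ u) ℤ.- (y ℤ.+ v)
    regroup = solve-∀

  minus-cong : ∀ {x y u v} → x ≈ y → u ≈ v → x ℤ.- u ≈ y ℤ.- v
  minus-cong {x} {y} {u} {v} (congruent q∣x-y) (congruent q∣u-v) =
    congruent (subst (+ q ∣_) (regroup x y u v) (∣m∣n⇒∣m-n q∣x-y q∣u-v))
    where
    regroup : ∀ x y u v → (x ℤ.- y) ℤ.- (u ℤ.- v) ≡ (x ℤ.- u) ℤ.- (y ℤ.- v)
    regroup = solve-∀

  +-multiple : ∀ x m → x ℤ.+ m ℤ.* + q ≈ x
  +-multiple x m = congruent (divides m (cancel x (m ℤ.* + q)))
    where
    cancel : ∀ x y → (x ℤ.+ y) ℤ.- x ≡ y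
    cancel = solve-∀

  small-multiple : ∀ {d} → + q ∣ + d → d < q → d ≡ 0
  small-multiple {zero}  _     _   = refl
  small-multiple {suc d} q∣d d<q = ⊥-elim (ℕDiv.>⇒∤ d<q (∣⇒∣ᵤ q∣d))

  congruent-close-≤ : ∀ {m n} → m ≤ n → + n ≈ + m → n < m + q → n ≡ m
  congruent-close-≤ {m} {n} m≤n (congruent q∣n-m) n<m+q =
    ℕP.≤-antisym (ℕP.m∸n≡0⇒m≤n (small-multiple q∣n∸m n∸m<q)) m≤n
    where
    q∣n∸m : + q ∣ + (n ∸ m)
    q∣n∸m = subst (+ q ∣_) (trans (ℤP.[+m]-[+n]≡m⊖n n m) (ℤP.≤-⊖ m≤n)) q∣n-m
    n∸m<q : n ∸ m < q
    n∸m<q = subst (n ∸ m <_) (ℕP.m+n∸m≡n m q) (ℕP.∸-monoˡ-< n<m+q m≤n)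

  congruent-close : ∀ {m n} → + m ≈ + n → m < n + q → n < m + q → m ≡ n
  congruent-close {m} {n} m≈n m<n+q n<m+q with ℕP.≤-total m n
  ... | inj₁ m≤n = sym (congruent-close-≤ m≤n (≈-sym m≈n) n<m+q)
  ... | inj₂ n≤m = congruent-close-≤ n≤m m≈n m<n+q

  shift-≈ : ∀ n → + (n + q) ≈ + n
  shift-≈ n = subst (_≈ + n) (cong (λ t → + n ℤ.+ t) (ℤP.*-identityˡ (+ q))) (+-multiple (+ n) (+ 1))

  congruent-near : .{{NonZero q}} → ∀ {m n} → + m ≈ + n → m < n + q + q → n < m + q + q →
    m + q ≡ n ⊎ m ≡ n ⊎ m ≡ n + q
  congruent-near {m} {n} m≈n m<n+2q n<m+2q with m + q ℕ.≤? n | n + q ℕ.≤? m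
  ... | yes m+q≤n | _ = inj₁ (congruent-close (≈-trans (shift-≈ m) m≈n) (ℕP.+-monoˡ-< q m<n) n<m+2q)
    where m<n = ℕP.<-≤-trans (ℕP.m<m+n m (ℕ.>-nonZero⁻¹ q)) m+q≤n
  ... | no _ | yes n+q≤m = inj₂ (inj₂ (sym (congruent-close (≈-trans (shift-≈ n) (≈-sym m≈n)) (ℕP.+-monoˡ-< q n<m) m<n+2q)))
    where n<m = ℕP.<-≤-trans (ℕP.m<m+n n (ℕ.>-nonZero⁻¹ q)) n+q≤m
  ... | no m+q≰n | no n+q≰m = inj₂ (inj₁ (congruent-close m≈n (ℕP.≰⇒> n+q≰m) (ℕP.≰⇒> m+q≰n)))

-- It is characterised by its congruence
-- class (π-spec, π-unique), hence it is a homomorphism for the operations of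
-- Defs, and it is onto on every block of q consecutive integers.
module Reduction (q : ℕ) {{_ : NonZero q}} where

  open Congruence q
  open import Relation.Binary.Reasoning.Setoid ≈-setoid

  π : ℤ → Fin q
  π x = fromℕ< (n%ℕd<d x q)

  π-spec : ∀ x → + toℕ (π x) ≈ x
  π-spec x = begin
    + toℕ (π x)                              ≡⟨ cong +_ (FinP.toℕ-fromℕ< (n%ℕd<d x q)) ⟩
    + (x %ℕ q)                               ≈⟨ +-multiple (+ (x %ℕ q)) (x ℤ./ℕ q) ⟨
    + (x %ℕ q) ℤ.+ (x ℤ./ℕ q) ℤ.* + q        ≡⟨ a≡a%ℕn+[a/ℕn]*n x q ⟨
    x                                        ∎

  mod-spec : ∀ n → + toℕ (n mod q) ≈ + n
  mod-spec n = π-spec (+ n)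

  π-unique : ∀ {x} r → + toℕ r ≈ x → π x ≡ r
  π-unique {x} r r≈x = FinP.toℕ-injective (congruent-close (≈-trans (π-spec x) (≈-sym r≈x))
    (ℕP.<-≤-trans (FinP.toℕ<n (π x)) (ℕP.m≤n+m q (toℕ r)))
    (ℕP.<-≤-trans (FinP.toℕ<n r) (ℕP.m≤n+m q (toℕ (π x)))))

  ⊕-spec : ∀ a b → + toℕ (a ⊕ b) ≈ + toℕ a ℤ.+ + toℕ b
  ⊕-spec a b = mod-spec (toℕ a + toℕ b)

  ⊖-spec : ∀ a b → + toℕ (a ⊖ b) ≈ + toℕ a ℤ.- + toℕ b
  ⊖-spec a b = begin
    + toℕ (a ⊖ b)                          ≈⟨ mod-spec (toℕ a + (q ∸ toℕ b)) ⟩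
    + toℕ a ℤ.+ + (q ∸ toℕ b)              ≡⟨ cong (λ t → + toℕ a ℤ.+ t) q-b ⟩
    + toℕ a ℤ.+ (+ q ℤ.- + toℕ b)          ≡⟨ regroup (+ toℕ a) (+ toℕ b) (+ q) ⟩
    (+ toℕ a ℤ.- + toℕ b) ℤ.+ + 1 ℤ.* + q  ≈⟨ +-multiple (+ toℕ a ℤ.- + toℕ b) (+ 1) ⟩
    + toℕ a ℤ.- + toℕ b                    ∎
    where
    q-b : + (q ∸ toℕ b) ≡ + q ℤ.- + toℕ b
    q-b = sym (trans (ℤP.[+m]-[+n]≡m⊖n q (toℕ b)) (ℤP.≤-⊖ (ℕP.<⇒≤ (FinP.toℕ<n b))))
    regroup : ∀ a b n → a ℤ.+ (n ℤ.- b) ≡ (a ℤ.- b) ℤ.+ + 1 ℤ.* n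
    regroup = solve-∀

  π-+ : ∀ x y → π (x ℤ.+ y) ≡ π x ⊕ π y
  π-+ x y = π-unique (π x ⊕ π y) (begin
    + toℕ (π x ⊕ π y)                 ≈⟨ ⊕-spec (π x) (π y) ⟩
    + toℕ (π x) ℤ.+ + toℕ (π y)       ≈⟨ +-cong (π-spec x) (π-spec y) ⟩
    x ℤ.+ y                           ∎)

  π-- : ∀ x y → π (x ℤ.- y) ≡ π x ⊖ π y
  π-- x y = π-unique (π x ⊖ π y) (begin
    + toℕ (π x ⊖ π y)                 ≈⟨ ⊖-spec (π x) (π y) ⟩
    + toℕ (π x) ℤ.- + toℕ (π y)       ≈⟨ minus-cong (π-spec x) (π-spec y) ⟩
    x ℤ.- y                           ∎)

  π-0 : π (+ 0) ≡ zeroQ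
  π-0 = π-unique zeroQ (mod-spec 0)

  π-onto-block : ∀ c r → ∃ λ i → 1 ≤ i × i ≤ q × π (c ℤ.+ + i) ≡ r
  π-onto-block c r = suc (toℕ t) , s≤s z≤n , FinP.toℕ<n t , π-unique r (begin
    + toℕ r                               ≡⟨ regroup c (+ toℕ r) ⟩
    (c ℤ.+ + 1) ℤ.+ offset                ≈⟨ +-cong (≈-reflexive {c ℤ.+ + 1} refl) (π-spec offset) ⟨
    (c ℤ.+ + 1) ℤ.+ + toℕ t               ≡⟨ shift c (+ toℕ t) ⟩
    c ℤ.+ + suc (toℕ t)                   ∎)
    where
    offset : ℤ
    offset = + toℕ r ℤ.- (c ℤ.+ + 1)
    t : Fin q
    t = π offset
    regroup : ∀ c r → r ≡ (c ℤ.+ + 1) ℤ.+ (r ℤ.- (c ℤ.+ + 1))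
    regroup = solve-∀
    shift : ∀ c t → (c ℤ.+ + 1) ℤ.+ t ≡ c ℤ.+ (+ 1 ℤ.+ t)
    shift = solve-∀

  π-sumset⁺ : ∀ {S T} → (∀ {s} → s ∈ S → π s ∈ T) →
    ∀ k {x} → x ∈ sumsetZ k S → π x ∈ sumsetQ q k T
  π-sumset⁺ S→T zero    (here refl) = here π-0
  π-sumset⁺ {S} {T} S→T (suc k) x∈ with ∈-sums⁻ ℤ._+_ S (sumsetZ k S) x∈
  ... | a , s , a∈ , s∈ , refl =
    subst (_∈ sumsetQ q (suc k) T) (sym (π-+ a s)) (∈-sums⁺ _⊕_ (S→T a∈) (π-sumset⁺ S→T k s∈))

  π-sumset⁻ : ∀ {S T} → (∀ {t} → t ∈ T → ∃ λ s → s ∈ S × π s ≡ t) →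
    ∀ k {y} → y ∈ sumsetQ q k T → ∃ λ x → x ∈ sumsetZ k S × π x ≡ y
  π-sumset⁻ T→S zero    (here refl) = + 0 , here refl , π-0
  π-sumset⁻ {S} {T} T→S (suc k) y∈ with ∈-sums⁻ _⊕_ T (sumsetQ q k T) y∈
  ... | t , u , t∈ , u∈ , refl with T→S t∈ | π-sumset⁻ T→S k u∈
  ...   | a , a∈ , refl | s , s∈ , refl = a ℤ.+ s , ∈-sums⁺ ℤ._+_ a∈ s∈ , π-+ a s

  reduce-diff-cover : ∀ A → ContainsIntervalDiff q A → DiffCoverQ q (map π A)
  reduce-diff-cover A (c , block) r =
    let i , 1≤i , i≤q , π[c+i]≡r = π-onto-block c r
        a , b , a∈ , b∈ , a-b≡c+i = block i 1≤i i≤q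
    in π a , π b , ∈-map⁺ π a∈ , ∈-map⁺ π b∈ ,
       trans (sym (π-- a b)) (trans (cong π a-b≡c+i) π[c+i]≡r)

  reduce-sumset-card : ∀ A k → cardQ (sumsetQ q k (map π A)) ≤ cardZ (sumsetZ k A)
  reduce-sumset-card A k = distinct-image ℤP._≟_ FinP._≟_ π (π-sumset⁻ lift k)
    where
    lift : ∀ {t} → t ∈ map π A → ∃ λ s → s ∈ A × π s ≡ t
    lift t∈ with ∈-map⁻ π t∈
    ... | s , s∈ , t≡πs = s , s∈ , sym t≡πs

interval-diff-card : ∀ q A → ContainsIntervalDiff q A → q ≤ cardZ (diffZ A)
interval-diff-card q A (c , block) =
  subst (_≤ cardZ (diffZ A)) (trans (length-map g (upTo q)) (length-upTo q))
    (length-≤-image id (map⁺ g-injective (upTo⁺ q)) in-diffs)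
  where
  g : ℕ → ℤ
  g i = c ℤ.+ + suc i

  g-injective : ∀ {i j} → g i ≡ g j → i ≡ j
  g-injective {i} {j} e = ℕP.suc-injective (ℤP.+-injective (∙-cancelˡ c (+ suc i) (+ suc j) e))

  in-diffs : ∀ {u} → u ∈ map g (upTo q) → ∃ λ v → v ∈ deduplicate ℤP._≟_ (diffZ A) × id v ≡ u
  in-diffs u∈ with ∈-map⁻ g u∈
  ... | i , i∈ , refl with block (suc i) (s≤s z≤n) (∈-upTo⁻ i∈)
  ...   | a , b , a∈ , b∈ , a-b≡gi =
    g i , ∈-deduplicate⁺ ℤP._≟_ (subst (_∈ diffZ A) a-b≡gi (∈-sums⁺ ℤ._-_ a∈ b∈)) , refl

interval-diff-mono : ∀ {q q'} A → q ≤ q' → ContainsIntervalDiff q' A → ContainsIntervalDiff q A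
interval-diff-mono A q≤q' (c , block) = c , λ i 1≤i i≤q → block i 1≤i (ℕP.≤-trans i≤q q≤q')

sumset-bounded : ∀ {S m} → (∀ {s} → s ∈ S → ∃ λ e → s ≡ + e × e < m) →
  ∀ k {x} → x ∈ sumsetZ (suc k) S → ∃ λ n → x ≡ + n × n < suc k * m
sumset-bounded {S} S<m zero x∈ with ∈-sums⁻ ℤ._+_ S (sumsetZ zero S) x∈
... | a , s , a∈ , here refl , refl with S<m a∈
...   | e , refl , e<m = e + 0 , refl , ℕP.+-monoˡ-< 0 e<m
sumset-bounded {S} S<m (suc k) x∈ with ∈-sums⁻ ℤ._+_ S (sumsetZ (suc k) S) x∈
... | a , s , a∈ , s∈ , refl with S<m a∈ | sumset-bounded S<m k s∈
...   | e , refl , e<m | n , refl , n<[k+1]m = e + n , refl , ℕP.+-mono-< e<m n<[k+1]m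

length-cartesianProduct : (xs : List A) (ys : List B) →
  length (cartesianProduct xs ys) ≡ length xs * length ys
length-cartesianProduct []       ys = refl
length-cartesianProduct (x ∷ xs) ys = begin
  length (map (x ,_) ys ++ cartesianProduct xs ys)     ≡⟨ length-++ (map (x ,_) ys) ⟩
  length (map (x ,_) ys) + length (cartesianProduct xs ys)
    ≡⟨ cong₂ _+_ (length-map (x ,_) ys) (length-cartesianProduct xs ys) ⟩
  length ys + length xs * length ys                    ∎
  where open ≡-Reasoning

module Doubling (q : ℕ) {{_ : NonZero q}} (A : List (Fin q)) where

  open Congruence q
  open Reduction q

  low high : Fin q → ℤ
  low a  = + toℕ a
  high a = + (toℕ a + q)

  doubled : List ℤ
  doubled = map low A ++ map high A

  low∈ : ∀ {a} → a ∈ A → low a ∈ doubled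
  low∈ a∈ = ∈-++⁺ˡ (∈-map⁺ low a∈)

  high∈ : ∀ {a} → a ∈ A → high a ∈ doubled
  high∈ a∈ = ∈-++⁺ʳ (map low A) (∈-map⁺ high a∈)

  doubled-view : ∀ {s} → s ∈ doubled → ∃ λ a → a ∈ A × (s ≡ low a ⊎ s ≡ high a)
  doubled-view s∈ with ∈-++⁻ (map low A) s∈
  ... | inj₁ s∈low with ∈-map⁻ low s∈low
  ...   | a , a∈ , s≡ = a , a∈ , inj₁ s≡
  doubled-view s∈ | inj₂ s∈high with ∈-map⁻ high s∈high
  ...   | a , a∈ , s≡ = a , a∈ , inj₂ s≡

  doubled-residue : ∀ {s} → s ∈ doubled → π s ∈ A
  doubled-residue s∈ with doubled-view s∈
  ... | a , a∈ , inj₁ refl = subst (_∈ A) (sym (π-unique a (≈-reflexive refl))) a∈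
  ... | a , a∈ , inj₂ refl = subst (_∈ A) (sym (π-unique a (≈-sym (shift-≈ (toℕ a))))) a∈

  doubled-bounded : ∀ {s} → s ∈ doubled → ∃ λ e → s ≡ + e × e < q + q
  doubled-bounded s∈ with doubled-view s∈
  ... | a , a∈ , inj₁ refl = toℕ a , refl , ℕP.<-≤-trans (FinP.toℕ<n a) (ℕP.m≤m+n q q)
  ... | a , a∈ , inj₂ refl = toℕ a + q , refl , ℕP.+-monoˡ-< q (FinP.toℕ<n a)

  -- |kA'| ≤ 2k·|kA|: an element n of kA' lies in [0, 2kq), so it is recovered
  -- from its residue, which lies in kA, and its quotient n / q < 2k.
  doubled-sumset-card : ∀ k → 1 ≤ k → cardZ (sumsetZ k doubled) ≤ 2 * k * cardQ (sumsetQ q k A)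
  doubled-sumset-card (suc k) _ = begin
    cardZ (sumsetZ K doubled)                   ≤⟨ distinct-≤-length ℤP._≟_ recombine decompose ⟩
    length (cartesianProduct D (upTo (2 * K)))  ≡⟨ length-cartesianProduct D (upTo (2 * K)) ⟩
    length D * length (upTo (2 * K))            ≡⟨ cong (length D *_) (length-upTo (2 * K)) ⟩
    length D * (2 * K)                          ≡⟨ ℕP.*-comm (length D) (2 * K) ⟩
    2 * K * length D                            ∎
    where
    open ℕP.≤-Reasoning
    K : ℕ
    K = suc k
    D : List (Fin q)
    D = deduplicate FinP._≟_ (sumsetQ q K A)

    recombine : Fin q × ℕ → ℤ
    recombine (r , t) = + (toℕ r + t * q)

    decompose : ∀ {x} → x ∈ sumsetZ K doubled →
      ∃ λ c → c ∈ cartesianProduct D (upTo (2 * K)) × recombine c ≡ x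
    decompose x∈ with sumset-bounded doubled-bounded k x∈
    ... | n , refl , n<K[q+q] =
      (n mod q , n / q) ,
      ∈-cartesianProduct⁺ (∈-deduplicate⁺ FinP._≟_ (π-sumset⁺ doubled-residue K x∈))
                          (∈-upTo⁺ (m<n*o⇒m/o<n (subst (n <_) (regroup K q) n<K[q+q]))) ,
      cong +_ (trans (cong (_+ n / q * q) (FinP.toℕ-fromℕ< (m%n<n n q))) (sym (m≡m%n+[m/n]*n n q)))
      where
      regroup : ∀ k q → k * (q + q) ≡ 2 * k * q
      regroup = ℕ-solve-∀

  realise : ∀ {j α β} → + α ∈ doubled → + β ∈ doubled → α + q ≡ j + β →
    ∃ λ a → ∃ λ b → a ∈ doubled × b ∈ doubled × a ℤ.- b ≡ -[1+ q ] ℤ.+ + suc j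
  realise {j} {α} {β} α∈ β∈ α+q≡j+β = + α , + β , α∈ , β∈ , (begin
    + α ℤ.- + β                   ≡⟨ add-and-subtract (+ α) (+ β) (+ q) ⟩
    + (α + q) ℤ.- + β ℤ.- + q     ≡⟨ cong (λ t → + t ℤ.- + β ℤ.- + q) α+q≡j+β ⟩
    + (j + β) ℤ.- + β ℤ.- + q     ≡⟨ cancel (+ j) (+ β) (+ q) ⟩
    -[1+ q ] ℤ.+ + suc j          ∎)
    where
    open ≡-Reasoning
    add-and-subtract : ∀ a b c → a ℤ.- b ≡ (a ℤ.+ c) ℤ.- b ℤ.- c
    add-and-subtract = solve-∀
    cancel : ∀ j b c → (j ℤ.+ b) ℤ.- b ℤ.- c ≡ ℤ.- (+ 1 ℤ.+ c) ℤ.+ (+ 1 ℤ.+ j)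
    cancel = solve-∀

  -- every j − q with 0 ≤ j ≤ 2q is a difference of A': if a, b ∈ A with
  -- a − b ≡ j (mod q), then j + b and a + q are congruent and less than 2q apart
  difference-from-pair : ∀ j → j ≤ q + q → ∀ {a b} → a ∈ A → b ∈ A → a ⊖ b ≡ j mod q →
    ∃ λ a → ∃ λ b → a ∈ doubled × b ∈ doubled × a ℤ.- b ≡ -[1+ q ] ℤ.+ + suc j
  difference-from-pair j j≤2q {a} {b} a∈ b∈ a⊖b≡j = by-cases (congruent-near X≈Y X<Y+2q Y<X+2q)
    where
    X Y : ℕ
    X = j + toℕ b
    Y = toℕ a + q

    X≈Y : + X ≈ + Y
    X≈Y = begin
      + j ℤ.+ + toℕ b                       ≈⟨ +-cong (mod-spec j) (≈-reflexive {+ toℕ b} refl) ⟨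
      + toℕ (j mod q) ℤ.+ + toℕ b           ≡⟨ cong (λ r → + toℕ r ℤ.+ + toℕ b) a⊖b≡j ⟨
      + toℕ (a ⊖ b) ℤ.+ + toℕ b             ≈⟨ +-cong (⊖-spec a b) (≈-reflexive {+ toℕ b} refl) ⟩
      (+ toℕ a ℤ.- + toℕ b) ℤ.+ + toℕ b     ≡⟨ cancel (+ toℕ a) (+ toℕ b) ⟩
      + toℕ a                               ≈⟨ shift-≈ (toℕ a) ⟨
      + (toℕ a + q)                         ∎
      where
      open import Relation.Binary.Reasoning.Setoid ≈-setoid
      cancel : ∀ a b → (a ℤ.- b) ℤ.+ b ≡ a
      cancel = solve-∀

    X<Y+2q : X < Y + q + q
    X<Y+2q = begin-strict
      j + toℕ b              <⟨ ℕP.+-mono-≤-< j≤2q (FinP.toℕ<n b) ⟩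
      q + q + q              ≤⟨ ℕP.m≤n+m (q + q + q) (toℕ a) ⟩
      toℕ a + (q + q + q)    ≡⟨ regroup (toℕ a) q ⟩
      toℕ a + q + q + q      ∎
      where
      open ℕP.≤-Reasoning
      regroup : ∀ a q → a + (q + q + q) ≡ a + q + q + q
      regroup = ℕ-solve-∀

    Y<X+2q : Y < X + q + q
    Y<X+2q = begin-strict
      toℕ a + q              <⟨ ℕP.+-monoˡ-< q (FinP.toℕ<n a) ⟩
      q + q                  ≤⟨ ℕP.m≤n+m (q + q) X ⟩
      X + (q + q)            ≡⟨ ℕP.+-assoc X q q ⟨
      X + q + q              ∎
      where open ℕP.≤-Reasoning

    by-cases : X + q ≡ Y ⊎ X ≡ Y ⊎ X ≡ Y + q →
      ∃ λ a → ∃ λ b → a ∈ doubled × b ∈ doubled × a ℤ.- b ≡ -[1+ q ] ℤ.+ + suc j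
    by-cases (inj₁ X+q≡Y)        = realise (low∈ a∈) (high∈ b∈) (trans (sym X+q≡Y) (ℕP.+-assoc j (toℕ b) q))
    by-cases (inj₂ (inj₁ X≡Y))   = realise (low∈ a∈) (low∈ b∈) (sym X≡Y)
    by-cases (inj₂ (inj₂ X≡Y+q)) = realise (high∈ a∈) (low∈ b∈) (sym X≡Y+q)

  doubled-diffs : DiffCoverQ q A → ContainsIntervalDiff (2 * q + 1) doubled
  doubled-diffs A-A=ℤq = -[1+ q ] , run
    where
    run : ∀ i → 1 ≤ i → i ≤ 2 * q + 1 →
      ∃ λ a → ∃ λ b → a ∈ doubled × b ∈ doubled × a ℤ.- b ≡ -[1+ q ] ℤ.+ + i
    run (suc j) _ i≤2q+1 =
      let a , b , a∈ , b∈ , a⊖b≡j = A-A=ℤq (j mod q)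
      in difference-from-pair j (ℕP.≤-pred (subst (suc j ≤_) (regroup q) i≤2q+1)) a∈ b∈ a⊖b≡j
      where
      regroup : ∀ q → 2 * q + 1 ≡ 1 + (q + q)
      regroup = ℕ-solve-∀

lemma3 : (k q : ℕ) → {{_ : NonZero q}} → 1 ≤ k → 2 ≤ q →
    (F G H G' : ℕ) →
    IsMinimum (FSet k q) F →
    IsMinimum (GSet k q) G →
    IsMinimum (HSet k q) H →
    IsMinimum (GSet k (2 * q + 1)) G' →
    F ≤ G × H ≤ G × G ≤ G' × G' ≤ 2 * k * F
lemma3 k q k≥1 _ F G H G' (F-attained , F-least) (G-attained , G-least) (_ , H-least) (G'-attained , G'-least) =
  F≤G , H≤G , G≤G' , G'≤2kF
  where
  open Reduction q

  F≤G : F ≤ G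
  F≤G = let A , A-A⊇run , |kA|≡G = G-attained
        in ℕP.≤-trans (F-least _ (map π A , reduce-diff-cover A A-A⊇run , refl))
                      (subst (_ ≤_) |kA|≡G (reduce-sumset-card A k))

  H≤G : H ≤ G
  H≤G = let A , A-A⊇run , |kA|≡G = G-attained
        in H-least G (A , interval-diff-card q A A-A⊇run , |kA|≡G)

  G≤G' : G ≤ G'
  G≤G' = let A , A-A⊇run , |kA|≡G' = G'-attained
             q≤2q+1 = ℕP.≤-trans (ℕP.m≤n*m q 2) (ℕP.m≤m+n (2 * q) 1)
         in G-least G' (A , interval-diff-mono A q≤2q+1 A-A⊇run , |kA|≡G')

  G'≤2kF : G' ≤ 2 * k * F
  G'≤2kF = let A , A-A=ℤq , |kA|≡F = F-attained
               open Doubling q A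
           in ℕP.≤-trans (G'-least _ (doubled , doubled-diffs A-A=ℤq , refl))
                         (subst (λ t → _ ≤ 2 * k * t) |kA|≡F (doubled-sumset-card k k≥1))
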